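{- Let $m\ge 1$ and $n$ be positive integers, and let $J(m)=\sum_{j=1}^m j\lfloor m/j\rfloor$. If $\binom{m+1}{2}\le n\le J(m)$, then there exist symmetric Knowlton-Graham partitions of $\{1,\ldots,n\}$ having order $m$.
   Context: Knowlton-Graham partitions of $\{1,\ldots,n\}$ are two partitions $A_1,\ldots,A_p$ and $B_1,\ldots,B_q$ of $\{1,\ldots,n\}$ into disjoint nonempty sets such that, for every pair of positive integers $j,k$, at most one element of $\{1,\ldots,n\}$ lies both in some $A$-set of cardinality $j$ and in some $B$-set of cardinality $k$. Their order is the largest cardinality among all the sets $A_1,\ldots,A_p,B_1,\ldots,B_q$. For such partitions of order $m$, let $a_{jk}\in\{0,1\}$ ($1\le j,k\le m$) be the number of elements lying in an $A$-set of cardinality $j$ and in a $B$-set of cardinality $k$; the partitions are called symmetric if the $m\times m$ matrix $(a_{jk})$ is symmetric, i.e. $a_{jk}=a_{kj}$ for all $j,k$. -}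

module Defs where

open import Data.Nat using (ℕ; zero; suc; _+_; _*_; _/_; _≤_)
open import Data.Fin using (Fin; _≟_)
open import Data.List using (List; length; filter; allFin)
open import Data.Product using (Σ; _×_; ∃)
open import Data.Sum using (_⊎_)
open import Relation.Binary.PropositionalEquality using (_≡_)

-- A partition of {1,…,n} (represented as Fin n) is given by a block-labelling
-- function: x and y lie in the same block iff their labels coincide.
-- Blocks are the nonempty fibres, so every set partition arises this way
-- (labels can be taken in Fin n since there are at most n blocks).
Partition : ℕ → Set
Partition n = Fin n → Fin n

blockSize : ∀ {n} → Partition n → Fin n → ℕ
blockSize {n} P x = length (filter (λ y → P y ≟ P x) (allFin n))

IsKnowltonGraham : ∀ {n} → Partition n → Partition n → Set
IsKnowltonGraham A B =
  ∀ x y → blockSize A x ≡ blockSize A y → blockSize B x ≡ blockSize B y → x ≡ y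

HasOrder : ∀ {n} → Partition n → Partition n → ℕ → Set
HasOrder A B m =
  (∀ x → blockSize A x ≤ m × blockSize B x ≤ m) ×
  ∃ (λ x → blockSize A x ≡ m ⊎ blockSize B x ≡ m)

-- symmetric: a_{jk} = a_{kj}; a_{jk} = 1 iff some x has (|A(x)|,|B(x)|) = (j,k)
-- (and a_{jk} ∈ {0,1} under the KG condition).
IsSymmetric : ∀ {n} → Partition n → Partition n → Set
IsSymmetric A B =
  ∀ x → ∃ λ y → blockSize A y ≡ blockSize B x × blockSize B y ≡ blockSize A x

J-aux : ℕ → ℕ → ℕ
J-aux m zero = 0
J-aux m (suc j) = J-aux m j + suc j * (m / suc j)

J : ℕ → ℕ
J m = J-aux m m

-- A symmetric 0/1 matrix R on 1 … m whose u-th row sum is a multiple of u, with row m nonzero, is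
-- realised by symmetric Knowlton–Graham partitions of order m of its set of ones: cut the ones of
-- row u into runs of u consecutive cells (the A-blocks) and those of column v into runs of v (the
-- B-blocks); the cell (u , v) is then the only element in blocks of sizes u and v.
-- Such R with row sums r_u exists whenever, for some b, r_u = u for u > b and b ≤ r_u ≤ m for u ≤ b:
-- sort 1 … m by r_u and put a zero at (u , v) exactly when the positions of u and v add up to the
-- position of some u′ > b. We take r_1 = t, r_u = u ⌊m/u⌋ for 2 ≤ u ≤ b and r_u = u for u > b,
-- with 1 ≤ b ≤ ⌈m/2⌉ and b ≤ t ≤ m. Moving t changes n = ∑ r_u in steps of one, the ranges of n for
-- consecutive b overlap, and b = t = 1 and b = ⌈m/2⌉, t = m give n = C(m+1, 2) and n = J(m).

module Submission where

open import Defs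
open import Data.Nat using (ℕ; _≤_; suc)
open import Data.Nat.Combinatorics using (_C_)
open import Data.Product using (Σ; _×_)

open import Data.Bool using (Bool; true; false; _∧_; if_then_else_)
open import Data.Bool.Properties using (∧-zeroʳ; ∧-identityʳ)
open import Data.Empty using (⊥-elim)
open import Data.Fin using (Fin; zero; suc)
import Data.Fin as Fin
open import Data.Fin.Properties using (any?)
open import Data.List using (List; []; _∷_; _++_; map; length; lookup; tabulate; allFin; filter)
open import Data.List.Membership.Propositional.Properties using (∈-lookup)
open import Data.List.Properties using (map-tabulate; tabulate-lookup; filter-≐)
open import Data.List.Relation.Unary.All as All using (All; []; _∷_)
open import Data.List.Relation.Unary.All.Properties using (++⁺)
open import Data.Nat
  using (zero; _+_; _*_; _∸_; _⊓_; _<_; z≤n; s≤s; _≡ᵇ_; _<ᵇ_; _/_; _%_; NonZero; ⌊_/2⌋; ⌈_/2⌉)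
open import Data.Nat.Combinatorics using (nC1≡n; nCk+nC[k+1]≡[n+1]C[k+1])
open import Data.Nat.DivMod
  using ( m≡m%n+[m/n]*n; m%n≡m∸m/n*n; m%n<n; m/n*n≤m; n/1≡n; m/n≡1+[m∸n]/n; m<n⇒m/n≡0
        ; m<n*o⇒m/o<n; m*n/n≡m)
open import Data.Nat.Divisibility using (_∣_; divides; 1∣_; ∣-refl; m∣m*n)
open import Data.Nat.Properties
open import Algebra.Properties.CommutativeSemigroup +-commutativeSemigroup using (interchange; xy∙z≈xz∙y)
open import Data.Product using (∃; _,_; proj₁; proj₂; swap; uncurry)
open import Data.Sum using (_⊎_; inj₁; inj₂)
open import Function using (_∘_; id)
open import Function.Bundles using (mk⇔)
open import Relation.Binary.Definitions using (DecidableEquality; tri<; tri≈; tri>)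
open import Relation.Binary.PropositionalEquality hiding (J)
open import Relation.Nullary using (Dec; yes; no; does; ¬_; contradiction)
open import Relation.Nullary.Decidable using (map′; _×-dec_; _⊎-dec_; dec-true; dec-false; does-⇔)

private variable
  A B : Set

𝟙 : Bool → ℕ
𝟙 true = 1
𝟙 false = 0

𝟙≤1 : ∀ b → 𝟙 b ≤ 1
𝟙≤1 true = ≤-refl
𝟙≤1 false = z≤n

does-true⇒ : ∀ {P : Set} (P? : Dec P) → does P? ≡ true → P
does-true⇒ (yes p) _ = p

∧-true⇒right : ∀ a {c} → a ∧ c ≡ true → c ≡ true
∧-true⇒right true c≡true = c≡true

𝟙-does-mono : ∀ {P Q : Set} → (P → Q) → (P? : Dec P) (Q? : Dec Q) → 𝟙 (does P?) ≤ 𝟙 (does Q?)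
𝟙-does-mono P⇒Q (yes p) (no ¬q) = ⊥-elim (¬q (P⇒Q p))
𝟙-does-mono _ (yes _) (yes _) = ≤-refl
𝟙-does-mono _ (no _) _ = z≤n

-- ∑ K f = f 1 + ⋯ + f K; the index 0 is never summed.
∑ : ℕ → (ℕ → ℕ) → ℕ
∑ zero f = 0
∑ (suc K) f = ∑ K f + f (suc K)

syntax ∑ K (λ i → e) = ∑[ i ≤ K ] e

InRange : ℕ → ℕ → Set
InRange K i = 1 ≤ i × i ≤ K

inRange-suc : ∀ {K i} → InRange K i → InRange (suc K) i
inRange-suc (1≤i , i≤K) = 1≤i , m≤n⇒m≤1+n i≤K

inRange-top : ∀ K → InRange (suc K) (suc K)
inRange-top K = s≤s z≤n , ≤-refl

inRange-below-top : ∀ {K i} → InRange (suc K) i → i ≢ suc K → InRange K i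
inRange-below-top (1≤i , i≤1+K) i≢1+K = 1≤i , ≤-pred (≤∧≢⇒< i≤1+K i≢1+K)

module _ {f g : ℕ → ℕ} where

  ∑-cong : ∀ K → (∀ i → InRange K i → f i ≡ g i) → ∑ K f ≡ ∑ K g
  ∑-cong zero f≗g = refl
  ∑-cong (suc K) f≗g =
    cong₂ _+_ (∑-cong K (λ i r → f≗g i (inRange-suc r))) (f≗g (suc K) (inRange-top K))

  ∑-mono-≤ : ∀ K → (∀ i → InRange K i → f i ≤ g i) → ∑ K f ≤ ∑ K g
  ∑-mono-≤ zero f≤g = z≤n
  ∑-mono-≤ (suc K) f≤g =
    +-mono-≤ (∑-mono-≤ K (λ i r → f≤g i (inRange-suc r))) (f≤g (suc K) (inRange-top K))

  ∑-mono-< : ∀ K a → InRange K a → f a < g a → (∀ i → InRange K i → f i ≤ g i) → ∑ K f < ∑ K g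
  ∑-mono-< zero a (1≤a , a≤0) _ _ = ⊥-elim (<⇒≱ 1≤a a≤0)
  ∑-mono-< (suc K) a r fa<ga f≤g with a ≟ suc K
  ... | yes refl = +-mono-≤-< (∑-mono-≤ K (λ i r → f≤g i (inRange-suc r))) fa<ga
  ... | no a≢top = +-mono-<-≤ (∑-mono-< K a (inRange-below-top r a≢top) fa<ga (λ i r → f≤g i (inRange-suc r)))
                              (f≤g (suc K) (inRange-top K))

  ∑-update : ∀ K a → InRange K a → (∀ i → InRange K i → i ≢ a → f i ≡ g i) →
    ∑ K f + g a ≡ ∑ K g + f a
  ∑-update zero a (1≤a , a≤0) _ = ⊥-elim (<⇒≱ 1≤a a≤0)
  ∑-update (suc K) a r f≗g with a ≟ suc K
  ... | yes refl =
    trans (cong (λ s → s + f a + g a) (∑-cong K (λ i r → f≗g i (inRange-suc r) (<⇒≢ (s≤s (proj₂ r))))))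
          (xy∙z≈xz∙y (∑ K g) (f a) (g a))
  ... | no a≢top = begin
    ∑ K f + f (suc K) + g a ≡⟨ xy∙z≈xz∙y (∑ K f) _ _ ⟩
    ∑ K f + g a + f (suc K) ≡⟨ cong₂ _+_ (∑-update K a (inRange-below-top r a≢top) (λ i r → f≗g i (inRange-suc r)))
                                         (f≗g (suc K) (inRange-top K) (a≢top ∘ sym)) ⟩
    ∑ K g + f a + g (suc K) ≡⟨ xy∙z≈xz∙y (∑ K g) _ _ ⟩
    ∑ K g + g (suc K) + f a ∎
    where open ≡-Reasoning

∑-zero : ∀ K {f} → (∀ i → InRange K i → f i ≡ 0) → ∑ K f ≡ 0
∑-zero zero f≗0 = refl
∑-zero (suc K) f≗0 = cong₂ _+_ (∑-zero K (λ i r → f≗0 i (inRange-suc r))) (f≗0 (suc K) (inRange-top K))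

∑-ones : ∀ K → ∑[ i ≤ K ] 1 ≡ K
∑-ones zero = refl
∑-ones (suc K) = trans (cong (_+ 1) (∑-ones K)) (+-comm K 1)

∑-distrib-+ : ∀ K f g → ∑[ i ≤ K ] (f i + g i) ≡ ∑ K f + ∑ K g
∑-distrib-+ zero f g = refl
∑-distrib-+ (suc K) f g =
  trans (cong (_+ (f (suc K) + g (suc K))) (∑-distrib-+ K f g)) (interchange (∑ K f) (∑ K g) _ _)

∑-swap : ∀ K L (F : ℕ → ℕ → ℕ) → ∑[ i ≤ K ] ∑[ j ≤ L ] F i j ≡ ∑[ j ≤ L ] ∑[ i ≤ K ] F i j
∑-swap zero L F = sym (∑-zero L (λ _ _ → refl))
∑-swap (suc K) L F =
  trans (cong (_+ ∑ L (F (suc K))) (∑-swap K L F)) (sym (∑-distrib-+ L (λ j → ∑[ i ≤ K ] F i j) (F (suc K))))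

∑-single : ∀ K {f} a → InRange K a → (∀ i → InRange K i → i ≢ a → f i ≡ 0) → ∑ K f ≡ f a
∑-single K {f} a r f≗0 = begin
  ∑ K f                  ≡⟨ +-identityʳ (∑ K f) ⟨
  ∑ K f + 0              ≡⟨ ∑-update {g = λ _ → 0} K a r f≗0 ⟩
  ∑[ i ≤ K ] 0 + f a     ≡⟨ cong (_+ f a) (∑-zero K (λ _ _ → refl)) ⟩
  f a                    ∎
  where open ≡-Reasoning

∑-mono-bound : ∀ f {K L} → K ≤ L → ∑ K f ≤ ∑ L f
∑-mono-bound f {L = zero} z≤n = ≤-refl
∑-mono-bound f {L = suc L} K≤1+L with m≤n⇒m<n∨m≡n K≤1+L
... | inj₁ K<1+L = ≤-trans (∑-mono-bound f (≤-pred K<1+L)) (m≤m+n (∑ L f) _)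
... | inj₂ refl = ≤-refl

∑𝟙< : ∀ K (p : ℕ → Bool) a → InRange K a → p a ≡ false → ∑[ i ≤ K ] 𝟙 (p i) < K
∑𝟙< K p a r pa =
  <-≤-trans (∑-mono-< K a r (subst (λ b → 𝟙 b < 1) (sym pa) (s≤s z≤n)) (λ i _ → 𝟙≤1 (p i)))
            (≤-reflexive (∑-ones K))

∑𝟙-witness : ∀ K (p : ℕ → Bool) → 1 ≤ ∑[ i ≤ K ] 𝟙 (p i) → Σ ℕ λ i → InRange K i × p i ≡ true
∑𝟙-witness (suc K) p ∑≥1 with p (suc K) in e
... | true = suc K , inRange-top K , e
... | false with i , r , pi ← ∑𝟙-witness K p (subst (1 ≤_) (+-identityʳ (∑[ i ≤ K ] 𝟙 (p i))) ∑≥1) =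
  i , inRange-suc r , pi

∑𝟙-unique : ∀ K (p : ℕ → Bool) →
  (∀ i j → InRange K i → InRange K j → p i ≡ true → p j ≡ true → i ≡ j) → ∑[ i ≤ K ] 𝟙 (p i) ≤ 1
∑𝟙-unique K p uniq with 1 ≤? ∑[ i ≤ K ] 𝟙 (p i)
... | no ∑≱1 = <⇒≤ (≰⇒> ∑≱1)
... | yes ∑≥1 with a , ra , pa ← ∑𝟙-witness K p ∑≥1 =
  subst (_≤ 1) (sym (∑-single K a ra vanishes)) (𝟙≤1 (p a))
  where
  vanishes : ∀ i → InRange K i → i ≢ a → 𝟙 (p i) ≡ 0
  vanishes i ri i≢a with p i in pi
  ... | true = ⊥-elim (i≢a (uniq i a ri ra pi pa))
  ... | false = refl

∑-≤1-tight : ∀ K {f} → (∀ i → InRange K i → f i ≤ 1) → ∑ K f ≡ K → ∀ i → InRange K i → f i ≡ 1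
∑-≤1-tight K {f} f≤1 ∑≡K i r with f i in fi | f≤1 i r
... | 0 | _ = ⊥-elim (<-irrefl (trans ∑≡K (sym (∑-ones K))) (∑-mono-< K i r (≤-reflexive (cong suc fi)) f≤1))
... | 1 | _ = refl
... | suc (suc _) | s≤s ()

∑-threshold : ∀ a K → ∑[ x ≤ K ] 𝟙 (a <ᵇ x) ≡ K ∸ a
∑-threshold a zero = sym (0∸n≡0 a)
∑-threshold a (suc K) with a <? suc K
... | yes a<1+K rewrite dec-true (a <? suc K) a<1+K =
  trans (cong (_+ 1) (∑-threshold a K)) (trans (+-comm (K ∸ a) 1) (sym (+-∸-assoc 1 (≤-pred a<1+K))))
... | no a≮1+K rewrite dec-false (a <? suc K) a≮1+K =
  trans (+-identityʳ _) (trans (∑-threshold a K)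
        (trans (m≤n⇒m∸n≡0 (≤-trans (n≤1+n K) 1+K≤a)) (sym (m≤n⇒m∸n≡0 1+K≤a))))
  where
  1+K≤a : suc K ≤ a
  1+K≤a = ≮⇒≥ a≮1+K

∑𝟙-at : ∀ K (p : ℕ → Bool) a → InRange K a → ∑[ i ≤ K ] 𝟙 (p i ∧ (i ≡ᵇ a)) ≡ 𝟙 (p a)
∑𝟙-at K p a r =
  trans (∑-single K a r vanishes) (cong 𝟙 (trans (cong (p a ∧_) (dec-true (a ≟ a) refl)) (∧-identityʳ (p a))))
  where
  vanishes : ∀ i → InRange K i → i ≢ a → 𝟙 (p i ∧ (i ≡ᵇ a)) ≡ 0
  vanishes i _ i≢a rewrite dec-false (i ≟ a) i≢a | ∧-zeroʳ (p i) = refl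

count : (A → Bool) → List A → ℕ
count p [] = 0
count p (x ∷ xs) = 𝟙 (p x) + count p xs

count-++ : ∀ (p : A → Bool) xs ys → count p (xs ++ ys) ≡ count p xs + count p ys
count-++ p [] ys = refl
count-++ p (x ∷ xs) ys = trans (cong (𝟙 (p x) +_) (count-++ p xs ys)) (sym (+-assoc (𝟙 (p x)) _ _))

count-true : ∀ (xs : List A) → count (λ _ → true) xs ≡ length xs
count-true [] = refl
count-true (x ∷ xs) = cong suc (count-true xs)

count-map : ∀ (p : A → Bool) (f : B → A) xs → count p (map f xs) ≡ count (p ∘ f) xs
count-map p f [] = refl
count-map p f (x ∷ xs) = cong (𝟙 (p (f x)) +_) (count-map p f xs)

count-lookup : ∀ (p : A → Bool) xs → count (p ∘ lookup xs) (allFin (length xs)) ≡ count p xs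
count-lookup p xs = begin
  count (p ∘ lookup xs) (tabulate id)   ≡⟨ count-map p (lookup xs) (tabulate id) ⟨
  count p (map (lookup xs) (tabulate id)) ≡⟨ cong (count p) (map-tabulate id (lookup xs)) ⟩
  count p (tabulate (lookup xs))        ≡⟨ cong (count p) (tabulate-lookup xs) ⟩
  count p xs                            ∎
  where open ≡-Reasoning

length-filter≡count : ∀ {P : A → Set} (P? : ∀ x → Dec (P x)) xs →
  length (filter P? xs) ≡ count (does ∘ P?) xs
length-filter≡count P? [] = refl
length-filter≡count P? (x ∷ xs) with P? x
... | yes _ = cong suc (length-filter≡count P? xs)
... | no _ = length-filter≡count P? xs

count-witness : ∀ (p : A → Bool) xs → 1 ≤ count p xs → Σ (Fin (length xs)) λ i → p (lookup xs i) ≡ true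
count-witness p (x ∷ xs) count≥1 with p x in px
... | true = zero , px
... | false with i , pi ← count-witness p xs count≥1 = suc i , pi

lookup-counted : ∀ (p : A → Bool) xs i → p (lookup xs i) ≡ true → 1 ≤ count p xs
lookup-counted p (x ∷ xs) zero px rewrite px = s≤s z≤n
lookup-counted p (x ∷ xs) (suc i) pi = ≤-trans (lookup-counted p xs i pi) (m≤n+m _ (𝟙 (p x)))

lookup-counted-twice : ∀ (p : A → Bool) xs i j → i ≢ j →
  p (lookup xs i) ≡ true → p (lookup xs j) ≡ true → 2 ≤ count p xs
lookup-counted-twice p (x ∷ xs) zero zero i≢j _ _ = ⊥-elim (i≢j refl)
lookup-counted-twice p (x ∷ xs) zero (suc j) _ px pj rewrite px = s≤s (lookup-counted p xs j pj)
lookup-counted-twice p (x ∷ xs) (suc i) zero _ pi px rewrite px = s≤s (lookup-counted p xs i pi)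
lookup-counted-twice p (x ∷ xs) (suc i) (suc j) i≢j pi pj =
  ≤-trans (lookup-counted-twice p xs i j (i≢j ∘ cong suc) pi pj) (m≤n+m _ (𝟙 (p x)))

lookup-injective : (_≟ᴬ_ : DecidableEquality A) → ∀ xs →
  (∀ k → count (λ x → does (x ≟ᴬ lookup xs k)) xs ≤ 1) → ∀ i j → lookup xs i ≡ lookup xs j → i ≡ j
lookup-injective _≟ᴬ_ xs at-most-once i j xᵢ≡xⱼ with i Fin.≟ j
... | yes i≡j = i≡j
... | no i≢j = contradiction (at-most-once i) (<⇒≱ twice)
  where
  twice : 2 ≤ count (λ x → does (x ≟ᴬ lookup xs i)) xs
  twice = lookup-counted-twice _ xs i j i≢j (dec-true (lookup xs i ≟ᴬ lookup xs i) refl)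
                                            (dec-true (lookup xs j ≟ᴬ lookup xs i) (sym xᵢ≡xⱼ))

-- The block of x is named by the first element carrying its label; the default argument of pick
-- is never used, it only spares an absurd case.
module LabelPartition {L : Set} (_≟ᴸ_ : DecidableEquality L) {n} (label : Fin n → L) where

  private
    pick : ∀ {l} → Dec (∃ λ y → label y ≡ l) → Fin n → Fin n
    pick (yes (y , _)) _ = y
    pick (no _) default = default

    firstWith : ∀ l → Dec (∃ λ y → label y ≡ l)
    firstWith l = any? (λ y → label y ≟ᴸ l)

    label-pick : ∀ {x} (w? : Dec (∃ λ y → label y ≡ label x)) → label (pick w? x) ≡ label x
    label-pick (yes (_ , e)) = e
    label-pick (no _) = refl

    pick-default-irrelevant : ∀ {l} (w? : Dec (∃ λ y → label y ≡ l)) → ∃ (λ y → label y ≡ l) →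
      ∀ d d′ → pick w? d ≡ pick w? d′
    pick-default-irrelevant (yes _) _ _ _ = refl
    pick-default-irrelevant (no ¬w) w _ _ = ⊥-elim (¬w w)

  partition : Partition n
  partition x = pick (firstWith (label x)) x

  same-block⇒same-label : ∀ {x y} → partition y ≡ partition x → label y ≡ label x
  same-block⇒same-label {x} {y} e =
    trans (sym (label-pick (firstWith (label y)))) (trans (cong label e) (label-pick (firstWith (label x))))

  same-label⇒same-block : ∀ {x y} → label y ≡ label x → partition y ≡ partition x
  same-label⇒same-block {x} {y} e =
    trans (pick-default-irrelevant (firstWith (label y)) (y , refl) y x) (cong (λ l → pick (firstWith l) x) e)

  blockSize-partition : ∀ x → blockSize partition x ≡ count (λ y → does (label y ≟ᴸ label x)) (allFin n)
  blockSize-partition x =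
    trans (cong length (filter-≐ _ _ (same-block⇒same-label , same-label⇒same-block) (allFin n)))
          (length-filter≡count (λ y → label y ≟ᴸ label x) (allFin n))

module _ {s : ℕ} .{{_ : NonZero s}} where

  quotient<⇒<multiple : ∀ {x c} → x / s < c → x < c * s
  quotient<⇒<multiple {x} {c} q<c = begin-strict
    x                   ≡⟨ m≡m%n+[m/n]*n x s ⟩
    x % s + x / s * s   <⟨ +-monoˡ-< (x / s * s) (m%n<n x s) ⟩
    suc (x / s) * s     ≤⟨ *-monoˡ-≤ s q<c ⟩
    c * s               ∎
    where open ≤-Reasoning

  quotient>⇒≤remainder : ∀ {x c} → c < x / s → s ≤ x ∸ c * s
  quotient>⇒≤remainder {x} {c} c<q = m+n≤o⇒m≤o∸n s (begin
    s + c * s           ≤⟨ *-monoˡ-≤ s c<q ⟩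
    x / s * s           ≤⟨ m/n*n≤m x s ⟩
    x                   ∎)
    where open ≤-Reasoning

  -- s ⊓ (x ∸ c * s) counts the y < x with y / s ≡ c.
  quotient-count-step : ∀ x c → s ⊓ (x ∸ c * s) + 𝟙 (x / s ≡ᵇ c) ≡ s ⊓ (suc x ∸ c * s)
  quotient-count-step x c with <-cmp (x / s) c
  ... | tri< q<c _ _ rewrite dec-false (x / s ≟ c) (<⇒≢ q<c) | m≤n⇒m∸n≡0 (<⇒≤ (quotient<⇒<multiple q<c))
                           | m≤n⇒m∸n≡0 (quotient<⇒<multiple q<c) = +-identityʳ (s ⊓ 0)
  ... | tri≈ _ refl _ rewrite dec-true (x / s ≟ x / s) refl = begin
    s ⊓ (x ∸ x / s * s) + 1      ≡⟨ cong (λ r → s ⊓ r + 1) (sym (m%n≡m∸m/n*n x s)) ⟩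
    s ⊓ (x % s) + 1              ≡⟨ cong (_+ 1) (m≥n⇒m⊓n≡n (<⇒≤ (m%n<n x s))) ⟩
    x % s + 1                    ≡⟨ +-comm (x % s) 1 ⟩
    suc (x % s)                  ≡⟨ m≥n⇒m⊓n≡n (m%n<n x s) ⟨
    s ⊓ suc (x % s)              ≡⟨ cong (λ r → s ⊓ suc r) (m%n≡m∸m/n*n x s) ⟩
    s ⊓ suc (x ∸ x / s * s)      ≡⟨ cong (s ⊓_) (+-∸-assoc 1 (m/n*n≤m x s)) ⟨
    s ⊓ (suc x ∸ x / s * s)      ∎
    where open ≡-Reasoning
  ... | tri> _ _ c<q rewrite dec-false (x / s ≟ c) (<⇒≢ c<q ∘ sym) | m≤n⇒m⊓n≡m (quotient>⇒≤remainder c<q)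
                           | m≤n⇒m⊓n≡m (≤-trans (quotient>⇒≤remainder c<q) (∸-monoˡ-≤ (c * s) (n≤1+n x))) =
    +-identityʳ s

rank : (ℕ → Bool) → ℕ → ℕ
rank p v = ∑[ w ≤ v ∸ 1 ] 𝟙 (p w)

count-rank-quotient : ∀ (p : ℕ → Bool) s .{{_ : NonZero s}} c K →
  ∑[ v ≤ K ] 𝟙 (p v ∧ (rank p v / s ≡ᵇ c)) ≡ s ⊓ (∑[ w ≤ K ] 𝟙 (p w) ∸ c * s)
count-rank-quotient p s c zero = sym (trans (cong (s ⊓_) (0∸n≡0 (c * s))) (⊓-zeroʳ s))
count-rank-quotient p s c (suc K) with p (suc K)
... | true = trans (cong (_+ 𝟙 (x / s ≡ᵇ c)) (count-rank-quotient p s c K))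
                   (trans (quotient-count-step x c) (cong (λ y → s ⊓ (y ∸ c * s)) (+-comm 1 x)))
  where
  x : ℕ
  x = ∑[ w ≤ K ] 𝟙 (p w)
... | false = trans (+-identityʳ _) (trans (count-rank-quotient p s c K)
                    (cong (λ y → s ⊓ (y ∸ c * s)) (sym (+-identityʳ _))))

Cell : Set
Cell = ℕ × ℕ

-- Unlike Data.Product.Properties.≡-dec, this makes does (c ≟ᶜ c′) compute to a conjunction of _≡ᵇ_.
_≟ᶜ_ : DecidableEquality Cell
(a , b) ≟ᶜ (c , d) = map′ (uncurry (cong₂ _,_)) (λ e → cong proj₁ e , cong proj₂ e) ((a ≟ c) ×-dec (b ≟ d))

-- x ÷ 0 = 0 is a junk value; it is only ever used with a positive divisor.
_÷_ : ℕ → ℕ → ℕ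
x ÷ zero = 0
x ÷ suc k = x / suc k

SymmetricKG : ℕ → ℕ → Set
SymmetricKG m n =
  Σ (Partition n) λ A → Σ (Partition n) λ B → IsKnowltonGraham A B × HasOrder A B m × IsSymmetric A B

module FromMatrix (m : ℕ) (R : ℕ → ℕ → Bool) (R-sym : ∀ u v → R u v ≡ R v u) where

  degree : ℕ → ℕ
  degree u = ∑[ v ≤ m ] 𝟙 (R u v)

  IsOne : Cell → Set
  IsOne (u , v) = InRange m u × InRange m v × R u v ≡ true

  isOne-swap : ∀ {c} → IsOne c → IsOne (swap c)
  isOne-swap {u , v} (ru , rv , Ruv) = rv , ru , trans (R-sym v u) Ruv

  onesInRow : ℕ → ℕ → List Cell
  onesInRow u zero = []
  onesInRow u (suc K) = onesInRow u K ++ (if R u (suc K) then (u , suc K) ∷ [] else [])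

  onesUpToRow : ℕ → List Cell
  onesUpToRow zero = []
  onesUpToRow (suc K) = onesUpToRow K ++ onesInRow (suc K) m

  ones : List Cell
  ones = onesUpToRow m

  count-onesInRow : ∀ p u K → count p (onesInRow u K) ≡ ∑[ v ≤ K ] 𝟙 (R u v ∧ p (u , v))
  count-onesInRow p u zero = refl
  count-onesInRow p u (suc K) = trans (count-++ p (onesInRow u K) _) (cong₂ _+_ (count-onesInRow p u K) last)
    where
    last : count p (if R u (suc K) then (u , suc K) ∷ [] else []) ≡ 𝟙 (R u (suc K) ∧ p (u , suc K))
    last with R u (suc K)
    ... | true = +-identityʳ _
    ... | false = refl

  count-onesUpToRow : ∀ p K → count p (onesUpToRow K) ≡ ∑[ u ≤ K ] ∑[ v ≤ m ] 𝟙 (R u v ∧ p (u , v))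
  count-onesUpToRow p zero = refl
  count-onesUpToRow p (suc K) =
    trans (count-++ p (onesUpToRow K) _) (cong₂ _+_ (count-onesUpToRow p K) (count-onesInRow p (suc K) m))

  count-ones : ∀ p → count p ones ≡ ∑[ u ≤ m ] ∑[ v ≤ m ] 𝟙 (R u v ∧ p (u , v))
  count-ones p = count-onesUpToRow p m

  count-ones-swap : ∀ p → count (p ∘ swap) ones ≡ count p ones
  count-ones-swap p = begin
    count (p ∘ swap) ones                         ≡⟨ count-ones (p ∘ swap) ⟩
    ∑[ u ≤ m ] ∑[ v ≤ m ] 𝟙 (R u v ∧ p (v , u))   ≡⟨ ∑-swap m m (λ u v → 𝟙 (R u v ∧ p (v , u))) ⟩
    ∑[ v ≤ m ] ∑[ u ≤ m ] 𝟙 (R u v ∧ p (v , u))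
      ≡⟨ ∑-cong m (λ v _ → ∑-cong m (λ u _ → cong (λ b → 𝟙 (b ∧ p (v , u))) (R-sym u v))) ⟩
    ∑[ v ≤ m ] ∑[ u ≤ m ] 𝟙 (R v u ∧ p (v , u))   ≡⟨ count-ones p ⟨
    count p ones                                  ∎
    where open ≡-Reasoning

  ∑-row : ∀ a (p : ℕ → ℕ → Bool) → InRange m a →
    ∑[ u ≤ m ] ∑[ v ≤ m ] 𝟙 (R u v ∧ ((u ≡ᵇ a) ∧ p u v)) ≡ ∑[ v ≤ m ] 𝟙 (R a v ∧ p a v)
  ∑-row a p ra = trans (∑-single m a ra vanishes)
                       (cong (λ b → ∑[ v ≤ m ] 𝟙 (R a v ∧ (b ∧ p a v))) (dec-true (a ≟ a) refl))
    where
    vanishes : ∀ u → InRange m u → u ≢ a → ∑[ v ≤ m ] 𝟙 (R u v ∧ ((u ≡ᵇ a) ∧ p u v)) ≡ 0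
    vanishes u _ u≢a rewrite dec-false (u ≟ a) u≢a = ∑-zero m (λ v _ → cong 𝟙 (∧-zeroʳ (R u v)))

  onesInRow-valid : ∀ {u} K → InRange m u → K ≤ m → All IsOne (onesInRow u K)
  onesInRow-valid zero ru K≤m = []
  onesInRow-valid {u} (suc K) ru K≤m = ++⁺ (onesInRow-valid K ru (≤-trans (n≤1+n K) K≤m)) last
    where
    last : All IsOne (if R u (suc K) then (u , suc K) ∷ [] else [])
    last with R u (suc K) in Ruv
    ... | true = (ru , (s≤s z≤n , K≤m) , Ruv) ∷ []
    ... | false = []

  onesUpToRow-valid : ∀ K → K ≤ m → All IsOne (onesUpToRow K)
  onesUpToRow-valid zero K≤m = []
  onesUpToRow-valid (suc K) K≤m =
    ++⁺ (onesUpToRow-valid K (≤-trans (n≤1+n K) K≤m)) (onesInRow-valid m (s≤s z≤n , K≤m) ≤-refl)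

  lookup-isOne : ∀ i → IsOne (lookup ones i)
  lookup-isOne i = All.lookup (onesUpToRow-valid m ≤-refl) (∈-lookup i)

  count-cell : ∀ a b → InRange m a → InRange m b → count (λ c → does (c ≟ᶜ (a , b))) ones ≡ 𝟙 (R a b)
  count-cell a b ra rb = trans (count-ones _) (trans (∑-row a (λ _ v → v ≡ᵇ b) ra) (∑𝟙-at m (R a) b rb))

  rowLabel : Cell → Cell
  rowLabel (u , v) = u , rank (R u) v ÷ u

  rank<degree : ∀ {u v} → IsOne (u , v) → rank (R u) v < degree u
  rank<degree {u} {suc v} (_ , (_ , v<m) , Ruv) = begin-strict
    ∑[ w ≤ v ] 𝟙 (R u w)                ≡⟨ +-identityʳ _ ⟨
    ∑[ w ≤ v ] 𝟙 (R u w) + 0            <⟨ +-monoʳ-< _ (subst (λ b → 0 < 𝟙 b) (sym Ruv) (s≤s z≤n)) ⟩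
    ∑[ w ≤ suc v ] 𝟙 (R u w)            ≤⟨ ∑-mono-bound (𝟙 ∘ R u) v<m ⟩
    degree u                            ∎
    where open ≤-Reasoning

  count-rowBlock : ∀ {c} → IsOne c → proj₁ c ∣ degree (proj₁ c) →
    count (λ c′ → does (rowLabel c′ ≟ᶜ rowLabel c)) ones ≡ proj₁ c
  count-rowBlock {u@(suc _) , v} isOne@(ru , _ , _) (divides d degree≡d*u) = begin
    count (λ c′ → does (rowLabel c′ ≟ᶜ rowLabel (u , v))) ones
      ≡⟨ count-ones _ ⟩
    ∑[ u′ ≤ m ] ∑[ v′ ≤ m ] 𝟙 (R u′ v′ ∧ ((u′ ≡ᵇ u) ∧ (rank (R u′) v′ ÷ u′ ≡ᵇ q)))
      ≡⟨ ∑-row u (λ u′ v′ → rank (R u′) v′ ÷ u′ ≡ᵇ q) ru ⟩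
    ∑[ v′ ≤ m ] 𝟙 (R u v′ ∧ (rank (R u) v′ / u ≡ᵇ q))
      ≡⟨ count-rank-quotient (R u) u q m ⟩
    u ⊓ (degree u ∸ q * u)
      ≡⟨ m≤n⇒m⊓n≡m (quotient>⇒≤remainder q<degree/u) ⟩
    u ∎
    where
    open ≡-Reasoning
    q : ℕ
    q = rank (R u) v / u
    q<degree/u : q < degree u / u
    q<degree/u = subst (q <_) (sym (trans (cong (_/ u) degree≡d*u) (m*n/n≡m d u)))
                       (m<n*o⇒m/o<n (subst (rank (R u) v <_) degree≡d*u (rank<degree isOne)))

  N : ℕ
  N = length ones

  cell : Fin N → Cell
  cell = lookup ones

  module A = LabelPartition _≟ᶜ_ (rowLabel ∘ cell)
  module B = LabelPartition _≟ᶜ_ (rowLabel ∘ swap ∘ cell)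

  cell-surjective : ∀ {c} → IsOne c → Σ (Fin N) λ x → cell x ≡ c
  cell-surjective {a , b} (ra , rb , Rab)
    with x , e ← count-witness (λ c → does (c ≟ᶜ (a , b))) ones
                   (≤-reflexive (sym (trans (count-cell a b ra rb) (cong 𝟙 Rab)))) =
    x , does-true⇒ (cell x ≟ᶜ (a , b)) e

  cell-injective : ∀ x y → cell x ≡ cell y → x ≡ y
  cell-injective = lookup-injective _≟ᶜ_ ones at-most-once
    where
    at-most-once : ∀ k → count (λ c → does (c ≟ᶜ cell k)) ones ≤ 1
    at-most-once k with ra , rb , _ ← lookup-isOne k = ≤-trans (≤-reflexive (count-cell _ _ ra rb)) (𝟙≤1 _)

  N≡∑degree : N ≡ ∑ m degree
  N≡∑degree = trans (sym (count-true ones))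
                    (trans (count-ones _) (∑-cong m (λ u _ → ∑-cong m (λ v _ → cong 𝟙 (∧-identityʳ (R u v))))))

  module _ (divisible : ∀ u → InRange m u → u ∣ degree u) where

    blockSize-A : ∀ x → blockSize A.partition x ≡ proj₁ (cell x)
    blockSize-A x with ru , _ ← lookup-isOne x = begin
      blockSize A.partition x                                               ≡⟨ A.blockSize-partition x ⟩
      count (λ y → does (rowLabel (cell y) ≟ᶜ rowLabel (cell x))) (allFin N) ≡⟨ count-lookup _ ones ⟩
      count (λ c → does (rowLabel c ≟ᶜ rowLabel (cell x))) ones
        ≡⟨ count-rowBlock (lookup-isOne x) (divisible _ ru) ⟩
      proj₁ (cell x)                                                        ∎
      where open ≡-Reasoning

    blockSize-B : ∀ x → blockSize B.partition x ≡ proj₂ (cell x)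
    blockSize-B x with _ , rv , _ ← lookup-isOne x = begin
      blockSize B.partition x
        ≡⟨ B.blockSize-partition x ⟩
      count (λ y → does (rowLabel (swap (cell y)) ≟ᶜ rowLabel (swap (cell x)))) (allFin N)
        ≡⟨ count-lookup _ ones ⟩
      count (λ c → does (rowLabel (swap c) ≟ᶜ rowLabel (swap (cell x)))) ones
        ≡⟨ count-ones-swap _ ⟩
      count (λ c → does (rowLabel c ≟ᶜ rowLabel (swap (cell x)))) ones
        ≡⟨ count-rowBlock (isOne-swap (lookup-isOne x)) (divisible _ rv) ⟩
      proj₂ (cell x) ∎
      where open ≡-Reasoning

    symmetricKG : 1 ≤ degree m → SymmetricKG m (∑ m degree)
    symmetricKG degree-m≥1 =
      subst (SymmetricKG m) N≡∑degree (A.partition , B.partition , kg , (bounded , attained) , symmetric)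
      where
      kg : IsKnowltonGraham A.partition B.partition
      kg x y eA eB = cell-injective x y (cong₂ _,_ (trans (sym (blockSize-A x)) (trans eA (blockSize-A y)))
                                                   (trans (sym (blockSize-B x)) (trans eB (blockSize-B y))))

      bounded : ∀ x → blockSize A.partition x ≤ m × blockSize B.partition x ≤ m
      bounded x with (_ , u≤m) , (_ , v≤m) , _ ← lookup-isOne x =
        subst (_≤ m) (sym (blockSize-A x)) u≤m , subst (_≤ m) (sym (blockSize-B x)) v≤m

      attained : Σ (Fin N) λ x → blockSize A.partition x ≡ m ⊎ blockSize B.partition x ≡ m
      attained with v , rv , Rmv ← ∑𝟙-witness m (R m) degree-m≥1
               with x , e ← cell-surjective ((≤-trans (proj₁ rv) (proj₂ rv) , ≤-refl) , rv , Rmv) =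
        x , inj₁ (trans (blockSize-A x) (cong proj₁ e))

      symmetric : IsSymmetric A.partition B.partition
      symmetric x with y , e ← cell-surjective (isOne-swap (lookup-isOne x)) =
        y , trans (blockSize-A y) (trans (cong proj₁ e) (sym (blockSize-B x)))
          , trans (blockSize-B y) (trans (cong proj₂ e) (sym (blockSize-A x)))

-- pos lists 1 … m by increasing D, a large x (b < x, so D x ≡ x) coming after every u with D u ≡ x.
-- Row u has a zero exactly at the v with pos u + pos v ≡ pos x for a large x; as pos is a bijection,
-- these v correspond to the large x after u, which are the m ∸ D u vertices x > D u.
module Threshold (m b : ℕ) (D : ℕ → ℕ)
  (D-large : ∀ u → InRange m u → b < u → D u ≡ u)
  (b≤D : ∀ u → InRange m u → b ≤ D u)
  (D≤m : ∀ u → InRange m u → D u ≤ m) where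

  _≺_ : ℕ → ℕ → Set
  v ≺ u = D v < D u ⊎ (D v ≡ D u × u < v)

  _≺?_ : ∀ v u → Dec (v ≺ u)
  v ≺? u = (D v <? D u) ⊎-dec ((D v ≟ D u) ×-dec (u <? v))

  ≺-irrefl : ∀ u → ¬ u ≺ u
  ≺-irrefl u (inj₁ Du<Du) = <-irrefl refl Du<Du
  ≺-irrefl u (inj₂ (_ , u<u)) = <-irrefl refl u<u

  ≺-trans : ∀ {w u v} → w ≺ u → u ≺ v → w ≺ v
  ≺-trans (inj₁ p) (inj₁ q) = inj₁ (<-trans p q)
  ≺-trans {w} (inj₁ p) (inj₂ (q , _)) = inj₁ (subst (D w <_) q p)
  ≺-trans {v = v} (inj₂ (p , _)) (inj₁ q) = inj₁ (subst (_< D v) (sym p) q)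
  ≺-trans (inj₂ (p , p′)) (inj₂ (q , q′)) = inj₂ (trans p q , <-trans q′ p′)

  ≺-connex : ∀ u v → u ≢ v → u ≺ v ⊎ v ≺ u
  ≺-connex u v u≢v with <-cmp (D u) (D v) | <-cmp u v
  ... | tri< Du<Dv _ _ | _ = inj₁ (inj₁ Du<Dv)
  ... | tri> _ _ Dv<Du | _ = inj₂ (inj₁ Dv<Du)
  ... | tri≈ _ Du≡Dv _ | tri< u<v _ _ = inj₂ (inj₂ (sym Du≡Dv , u<v))
  ... | tri≈ _ _ _ | tri≈ _ u≡v _ = contradiction u≡v u≢v
  ... | tri≈ _ Du≡Dv _ | tri> _ _ v<u = inj₁ (inj₂ (Du≡Dv , v<u))

  pos : ℕ → ℕ
  pos u = suc (∑[ w ≤ m ] 𝟙 (does (w ≺? u)))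

  pos-mono : ∀ {u v} → InRange m u → u ≺ v → pos u < pos v
  pos-mono {u} {v} ru u≺v =
    s≤s (∑-mono-< m u ru u-counted-once
                  (λ w _ → 𝟙-does-mono (λ w≺u → ≺-trans w≺u u≺v) (w ≺? u) (w ≺? v)))
    where
    u-counted-once : 𝟙 (does (u ≺? u)) < 𝟙 (does (u ≺? v))
    u-counted-once rewrite dec-false (u ≺? u) (≺-irrefl u) | dec-true (u ≺? v) u≺v = s≤s z≤n

  pos-range : ∀ {u} → InRange m u → InRange m (pos u)
  pos-range {u} ru = s≤s z≤n , ∑𝟙< m (λ w → does (w ≺? u)) u ru (dec-false (u ≺? u) (≺-irrefl u))

  pos-injective : ∀ {u v} → InRange m u → InRange m v → pos u ≡ pos v → u ≡ v
  pos-injective {u} {v} ru rv pu≡pv with u ≟ v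
  ... | yes u≡v = u≡v
  ... | no u≢v with ≺-connex u v u≢v
  ...   | inj₁ u≺v = contradiction pu≡pv (<⇒≢ (pos-mono ru u≺v))
  ...   | inj₂ v≺u = contradiction (sym pu≡pv) (<⇒≢ (pos-mono rv v≺u))

  pos-fibre : ∀ q → InRange m q → ∑[ v ≤ m ] 𝟙 (q ≡ᵇ pos v) ≡ 1
  pos-fibre = ∑-≤1-tight m (λ q _ → fibre≤1 q) total
    where
    fibre≤1 : ∀ q → ∑[ v ≤ m ] 𝟙 (q ≡ᵇ pos v) ≤ 1
    fibre≤1 q = ∑𝟙-unique m (λ v → q ≡ᵇ pos v) λ i j ri rj qi qj →
      pos-injective ri rj (trans (sym (does-true⇒ (q ≟ pos i) qi)) (does-true⇒ (q ≟ pos j) qj))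
    total : ∑[ q ≤ m ] ∑[ v ≤ m ] 𝟙 (q ≡ᵇ pos v) ≡ m
    total = trans (∑-swap m m (λ q v → 𝟙 (q ≡ᵇ pos v)))
                  (trans (∑-cong m (λ v rv → ∑𝟙-at m (λ _ → true) (pos v) (pos-range rv))) (∑-ones m))

  pos<⇔≺ : ∀ {u x} → InRange m u → InRange m x → does (pos u <? pos x) ≡ does (u ≺? x)
  pos<⇔≺ {u} {x} ru rx = does-⇔ (mk⇔ pos<⇒≺ (pos-mono ru)) (pos u <? pos x) (u ≺? x)
    where
    pos<⇒≺ : pos u < pos x → u ≺ x
    pos<⇒≺ pu<px with u ≟ x
    ... | yes refl = contradiction pu<px (<-irrefl refl)
    ... | no u≢x with ≺-connex u x u≢x
    ...   | inj₁ u≺x = u≺x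
    ...   | inj₂ x≺u = contradiction (pos-mono rx x≺u) (<-asym pu<px)

  ≺large⇔ : ∀ {u x} → InRange m u → InRange m x → b < x → does (u ≺? x) ≡ does (D u <? x)
  ≺large⇔ {u} {x} ru rx b<x = does-⇔ (mk⇔ ≺⇒D< D<⇒≺) (u ≺? x) (D u <? x)
    where
    Dx≡x : D x ≡ x
    Dx≡x = D-large x rx b<x
    D<⇒≺ : D u < x → u ≺ x
    D<⇒≺ Du<x = inj₁ (subst (D u <_) (sym Dx≡x) Du<x)
    ≺⇒D< : u ≺ x → D u < x
    ≺⇒D< (inj₁ Du<Dx) = subst (D u <_) Dx≡x Du<Dx
    ≺⇒D< (inj₂ (Du≡Dx , x<u)) with b <? u
    ... | yes b<u = contradiction (trans (sym (D-large u ru b<u)) (trans Du≡Dx Dx≡x)) (<⇒≢ x<u ∘ sym)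
    ... | no b≮u = contradiction (<-≤-trans x<u (≮⇒≥ b≮u)) (<-asym b<x)

  blocked : ℕ → ℕ
  blocked s = ∑[ x ≤ m ] 𝟙 ((b <ᵇ x) ∧ (s ≡ᵇ pos x))

  blocked≤1 : ∀ s → blocked s ≤ 1
  blocked≤1 s = ∑𝟙-unique m (λ x → (b <ᵇ x) ∧ (s ≡ᵇ pos x)) λ i j ri rj bi bj →
    pos-injective ri rj (trans (sym (does-true⇒ (s ≟ pos i) (∧-true⇒right (b <ᵇ i) bi)))
                               (does-true⇒ (s ≟ pos j) (∧-true⇒right (b <ᵇ j) bj)))

  R : ℕ → ℕ → Bool
  R u v = blocked (pos u + pos v) ≡ᵇ 0

  R-sym : ∀ u v → R u v ≡ R v u
  R-sym u v = cong (λ s → blocked s ≡ᵇ 0) (+-comm (pos u) (pos v))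

  shifts : ∀ {u x} → InRange m u → InRange m x →
    ∑[ v ≤ m ] 𝟙 (pos u + pos v ≡ᵇ pos x) ≡ 𝟙 (does (pos u <? pos x))
  shifts {u} {x} ru rx with pos u <? pos x
  ... | yes pu<px rewrite dec-true (pos u <? pos x) pu<px =
    trans (∑-cong m λ v _ → cong 𝟙 (does-⇔ (mk⇔ (shift⇒ v) (shift⇐ v)) (pos u + pos v ≟ pos x) (q ≟ pos v)))
          (pos-fibre q (m<n⇒0<n∸m pu<px , ≤-trans (m∸n≤m (pos x) (pos u)) (proj₂ (pos-range rx))))
    where
    q : ℕ
    q = pos x ∸ pos u
    shift⇒ : ∀ v → pos u + pos v ≡ pos x → q ≡ pos v
    shift⇒ v e = trans (cong (_∸ pos u) (sym e)) (m+n∸m≡n (pos u) (pos v))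
    shift⇐ : ∀ v → q ≡ pos v → pos u + pos v ≡ pos x
    shift⇐ v e = trans (cong (pos u +_) (sym e)) (m+[n∸m]≡n (<⇒≤ pu<px))
  ... | no pu≮px rewrite dec-false (pos u <? pos x) pu≮px =
    ∑-zero m λ v _ → cong 𝟙 (dec-false (pos u + pos v ≟ pos x)
                                        λ e → pu≮px (subst (pos u <_) e (m<m+n (pos u) (s≤s z≤n))))

  large-shifts : ∀ {u x} → InRange m u → InRange m x →
    ∑[ v ≤ m ] 𝟙 ((b <ᵇ x) ∧ (pos u + pos v ≡ᵇ pos x)) ≡ 𝟙 (D u <ᵇ x)
  large-shifts {u} {x} ru rx with b <? x
  ... | yes b<x rewrite dec-true (b <? x) b<x =
    trans (shifts ru rx) (cong 𝟙 (trans (pos<⇔≺ ru rx) (≺large⇔ ru rx b<x)))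
  ... | no b≮x rewrite dec-false (b <? x) b≮x =
    trans (∑-zero m (λ _ _ → refl))
          (cong 𝟙 (sym (dec-false (D u <? x) (≤⇒≯ (≤-trans (≮⇒≥ b≮x) (b≤D u ru))))))

  ∑-blocked : ∀ {u} → InRange m u → ∑[ v ≤ m ] blocked (pos u + pos v) ≡ m ∸ D u
  ∑-blocked {u} ru = begin
    ∑[ v ≤ m ] ∑[ x ≤ m ] 𝟙 ((b <ᵇ x) ∧ (pos u + pos v ≡ᵇ pos x)) ≡⟨ ∑-swap m m _ ⟩
    ∑[ x ≤ m ] ∑[ v ≤ m ] 𝟙 ((b <ᵇ x) ∧ (pos u + pos v ≡ᵇ pos x))
      ≡⟨ ∑-cong m (λ _ rx → large-shifts ru rx) ⟩
    ∑[ x ≤ m ] 𝟙 (D u <ᵇ x)                                        ≡⟨ ∑-threshold (D u) m ⟩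
    m ∸ D u                                                        ∎
    where open ≡-Reasoning

  degree-R : ∀ u → InRange m u → ∑[ v ≤ m ] 𝟙 (R u v) ≡ D u
  degree-R u ru = begin
    ones                 ≡⟨ m+n∸n≡m ones zeros ⟨
    ones + zeros ∸ zeros ≡⟨ cong₂ _∸_ ones+zeros (∑-blocked ru) ⟩
    m ∸ (m ∸ D u)        ≡⟨ m∸[m∸n]≡n (D≤m u ru) ⟩
    D u                  ∎
    where
    open ≡-Reasoning
    ones zeros : ℕ
    ones = ∑[ v ≤ m ] 𝟙 (R u v)
    zeros = ∑[ v ≤ m ] blocked (pos u + pos v)
    𝟙[≡0]+ : ∀ n → n ≤ 1 → 𝟙 (n ≡ᵇ 0) + n ≡ 1
    𝟙[≡0]+ 0 _ = refl
    𝟙[≡0]+ 1 _ = refl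
    𝟙[≡0]+ (suc (suc _)) (s≤s ())
    ones+zeros : ones + zeros ≡ m
    ones+zeros = trans (sym (∑-distrib-+ m _ _))
                       (trans (∑-cong m (λ v _ → 𝟙[≡0]+ _ (blocked≤1 (pos u + pos v)))) (∑-ones m))

∑-identity≡C2 : ∀ m → ∑[ i ≤ m ] i ≡ suc m C 2
∑-identity≡C2 zero = refl
∑-identity≡C2 (suc m) = begin
  ∑[ i ≤ m ] i + suc m   ≡⟨ cong₂ _+_ (∑-identity≡C2 m) (sym (nC1≡n (suc m))) ⟩
  suc m C 2 + suc m C 1  ≡⟨ +-comm (suc m C 2) _ ⟩
  suc m C 1 + suc m C 2  ≡⟨ nCk+nC[k+1]≡[n+1]C[k+1] (suc m) 1 ⟩
  suc (suc m) C 2        ∎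
  where open ≡-Reasoning

module _ (lo hi : ℕ → ℕ) where

  interval-cover : ∀ k → (∀ b → 1 ≤ b → b ≤ k → lo (suc b) ≤ suc (hi b)) →
    ∀ {n} → lo 1 ≤ n → n ≤ hi (suc k) → Σ ℕ λ b → 1 ≤ b × b ≤ suc k × lo b ≤ n × n ≤ hi b
  interval-cover zero _ lo₁≤n n≤hi = 1 , ≤-refl , ≤-refl , lo₁≤n , n≤hi
  interval-cover (suc k) adjacent {n} lo₁≤n n≤hi with n ≤? hi (suc k)
  ... | yes n≤hi′ =
    widen (interval-cover k (λ b 1≤b b≤k → adjacent b 1≤b (m≤n⇒m≤1+n b≤k)) lo₁≤n n≤hi′)
    where
    widen : (Σ ℕ λ b → 1 ≤ b × b ≤ suc k × lo b ≤ n × n ≤ hi b) →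
            Σ ℕ λ b → 1 ≤ b × b ≤ suc (suc k) × lo b ≤ n × n ≤ hi b
    widen (b , 1≤b , b≤1+k , bounds) = b , 1≤b , m≤n⇒m≤1+n b≤1+k , bounds
  ... | no n≰hi′ =
    suc (suc k) , s≤s z≤n , ≤-refl , ≤-trans (adjacent (suc k) (s≤s z≤n) ≤-refl) (≰⇒> n≰hi′) , n≤hi

half-bounds : ∀ {m} → 1 ≤ m → Σ ℕ λ B → 1 ≤ B × B ≤ m × B + B ≤ suc m × m ≤ B + B
half-bounds {suc m} _ =
  suc k , s≤s z≤n , s≤s (⌊n/2⌋≤n m) , s≤s (≤-trans (≤-reflexive (+-suc k k)) (s≤s 2k≤m)) , s≤s m≤k+1+k
  where
  k : ℕ
  k = ⌊ m /2⌋
  split : k + ⌈ m /2⌉ ≡ m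
  split = ⌊n/2⌋+⌈n/2⌉≡n m
  2k≤m : k + k ≤ m
  2k≤m = ≤-trans (+-monoʳ-≤ k (⌊n/2⌋≤⌈n/2⌉ m)) (≤-reflexive split)
  m≤k+1+k : m ≤ k + suc k
  m≤k+1+k = ≤-trans (≤-reflexive (sym split)) (+-monoʳ-≤ k (⌊n/2⌋-mono (n≤1+n (suc m))))

module Profile (m : ℕ) where

  M : ℕ → ℕ
  M u = u * (m ÷ u)

  J≡∑M : J m ≡ ∑ m M
  J≡∑M = go m
    where
    go : ∀ j → J-aux m j ≡ ∑ j M
    go zero = refl
    go (suc j) = cong (_+ M (suc j)) (go j)

  M≤m : ∀ u → M u ≤ m
  M≤m zero = z≤n
  M≤m (suc u) = subst (_≤ m) (*-comm (m / suc u) (suc u)) (m/n*n≤m m (suc u))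

  m<M+u : ∀ u → 1 ≤ u → m < M u + u
  m<M+u u@(suc _) _ = begin-strict
    m                   ≡⟨ m≡m%n+[m/n]*n m u ⟩
    m % u + m / u * u   <⟨ +-monoˡ-< (m / u * u) (m%n<n m u) ⟩
    u + m / u * u       ≡⟨ +-comm u _ ⟩
    m / u * u + u       ≡⟨ cong (_+ u) (*-comm (m / u) u) ⟩
    M u + u             ∎
    where open ≤-Reasoning

  M≡id : ∀ u → u ≤ m → m < u + u → M u ≡ u
  M≡id u@(suc _) u≤m m<2u = begin
    u * (m / u)               ≡⟨ cong (u *_) (m/n≡1+[m∸n]/n u≤m) ⟩
    u * suc ((m ∸ u) / u)     ≡⟨ cong (λ q → u * suc q) (m<n⇒m/n≡0 (m<n+o⇒m∸n<o m u m<2u)) ⟩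
    u * 1                     ≡⟨ *-identityʳ u ⟩
    u                         ∎
    where open ≡-Reasoning

  -- The first argument is at least 1 wherever profile is used, so u ≡ 1 never counts as large.
  profile : ℕ → ℕ → ℕ → ℕ
  profile b t (suc zero) = t
  profile b t u = if b <ᵇ u then u else M u

  profileSum : ℕ → ℕ → ℕ
  profileSum b t = ∑ m (profile b t)

  profile-cases : ∀ b t u → 2 ≤ u → (b < u × profile b t u ≡ u) ⊎ (u ≤ b × profile b t u ≡ M u)
  profile-cases b t (suc zero) (s≤s ())
  profile-cases b t u@(suc (suc _)) _ with b <? u
  ... | yes b<u rewrite dec-true (b <? u) b<u = inj₁ (b<u , refl)
  ... | no b≮u rewrite dec-false (b <? u) b≮u = inj₂ (≮⇒≥ b≮u , refl)

  profile-large : ∀ {b} t u → 1 ≤ b → b < u → profile b t u ≡ u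
  profile-large {b} t u 1≤b b<u with profile-cases b t u (≤-trans (s≤s 1≤b) b<u)
  ... | inj₁ (_ , eq) = eq
  ... | inj₂ (u≤b , _) = contradiction u≤b (<⇒≱ b<u)

  profile-small : ∀ {b} t u → 2 ≤ u → u ≤ b → profile b t u ≡ M u
  profile-small {b} t u 2≤u u≤b with profile-cases b t u 2≤u
  ... | inj₁ (b<u , _) = contradiction u≤b (<⇒≱ b<u)
  ... | inj₂ (_ , eq) = eq

  profile-admissible : ∀ {b t} → b + b ≤ suc m → b ≤ t → t ≤ m → ∀ u → InRange m u →
    b ≤ profile b t u × profile b t u ≤ m × u ∣ profile b t u
  profile-admissible _ b≤t t≤m (suc zero) _ = b≤t , t≤m , 1∣ _
  profile-admissible {b} {t} b+b≤1+m _ _ u@(suc (suc _)) (_ , u≤m) with profile-cases b t u (s≤s (s≤s z≤n))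
  ... | inj₁ (b<u , eq) rewrite eq = <⇒≤ b<u , u≤m , ∣-refl
  ... | inj₂ (u≤b , eq) rewrite eq = b≤M , M≤m u , m∣m*n (m ÷ u)
    where
    b≤M : b ≤ M u
    b≤M = +-cancelʳ-≤ b b (M u) (≤-trans b+b≤1+m (≤-trans (m<M+u u (s≤s z≤n)) (+-monoʳ-≤ (M u) u≤b)))

  profileSum-slope : ∀ b t → 1 ≤ m → profileSum b t ≡ profileSum b 0 + t
  profileSum-slope b t 1≤m = trans (sym (+-identityʳ _)) (∑-update m 1 (≤-refl , 1≤m) agree)
    where
    agree : ∀ u → InRange m u → u ≢ 1 → profile b t u ≡ profile b 0 u
    agree (suc zero) _ u≢1 = contradiction refl u≢1
    agree (suc (suc _)) _ _ = refl

  profileSum-step : ∀ b t → 1 ≤ b → b < m → profileSum (suc b) t + suc b ≡ profileSum b t + M (suc b)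
  profileSum-step b t 1≤b b<m = begin
    profileSum (suc b) t + suc b
      ≡⟨ cong (profileSum (suc b) t +_) (profile-large t (suc b) 1≤b ≤-refl) ⟨
    profileSum (suc b) t + profile b t (suc b)
      ≡⟨ ∑-update m (suc b) (s≤s z≤n , b<m) agree ⟩
    profileSum b t + profile (suc b) t (suc b)
      ≡⟨ cong (profileSum b t +_) (profile-small t (suc b) (s≤s 1≤b) ≤-refl) ⟩
    profileSum b t + M (suc b) ∎
    where
    open ≡-Reasoning
    agree : ∀ u → InRange m u → u ≢ suc b → profile (suc b) t u ≡ profile b t u
    agree (suc zero) _ _ = refl
    agree u@(suc (suc _)) _ u≢1+b with <-cmp u (suc b)
    ... | tri< u<1+b _ _ = trans (profile-small t u (s≤s (s≤s z≤n)) (<⇒≤ u<1+b))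
                                 (sym (profile-small t u (s≤s (s≤s z≤n)) (≤-pred u<1+b)))
    ... | tri≈ _ u≡1+b _ = contradiction u≡1+b u≢1+b
    ... | tri> _ _ 1+b<u = trans (profile-large t u (s≤s z≤n) 1+b<u)
                                 (sym (profile-large t u 1≤b (<-trans ≤-refl 1+b<u)))

  profileSum-first : 1 ≤ m → profileSum 1 0 + 1 ≡ suc m C 2
  profileSum-first 1≤m = trans (sym (profileSum-slope 1 1 1≤m)) (trans (∑-cong m identity) (∑-identity≡C2 m))
    where
    identity : ∀ u → InRange m u → profile 1 1 u ≡ u
    identity (suc zero) _ = refl
    identity (suc (suc _)) _ = refl

  profileSum-last : ∀ B → 1 ≤ m → m ≤ B + B → profileSum B 0 + m ≡ J m
  profileSum-last B 1≤m m≤2B = trans (sym (profileSum-slope B m 1≤m)) (trans (∑-cong m agree) (sym J≡∑M))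
    where
    agree : ∀ u → InRange m u → profile B m u ≡ M u
    agree (suc zero) _ = sym (trans (*-identityˡ (m / 1)) (n/1≡n m))
    agree u@(suc (suc _)) (_ , u≤m) with profile-cases B m u (s≤s (s≤s z≤n))
    ... | inj₁ (B<u , eq) = trans eq (sym (M≡id u u≤m (≤-<-trans m≤2B (+-mono-< B<u B<u))))
    ... | inj₂ (_ , eq) = eq

  record Admissible (b t : ℕ) : Set where
    field
      1≤b : 1 ≤ b
      b+b≤1+m : b + b ≤ suc m
      b≤t : b ≤ t
      t≤m : t ≤ m

  profileSum-realisable : ∀ {b t} → Admissible b t → SymmetricKG m (profileSum b t)
  profileSum-realisable {b} {t} adm =
    subst (SymmetricKG m) (∑-cong m degree-R) (symmetricKG divisible degree-m≥1)
    where
    open Admissible adm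
    admissible : ∀ u → InRange m u → b ≤ profile b t u × profile b t u ≤ m × u ∣ profile b t u
    admissible = profile-admissible b+b≤1+m b≤t t≤m
    open Threshold m b (profile b t) (λ u _ → profile-large t u 1≤b) (λ u r → proj₁ (admissible u r))
                                     (λ u r → proj₁ (proj₂ (admissible u r)))
    open FromMatrix m R R-sym
    divisible : ∀ u → InRange m u → u ∣ degree u
    divisible u r = subst (u ∣_) (sym (degree-R u r)) (proj₂ (proj₂ (admissible u r)))
    m-inRange : InRange m m
    m-inRange = ≤-trans 1≤b (≤-trans b≤t t≤m) , ≤-refl
    degree-m≥1 : 1 ≤ degree m
    degree-m≥1 = ≤-trans 1≤b (subst (b ≤_) (sym (degree-R m m-inRange)) (proj₁ (admissible m m-inRange)))

  profileSum-adjacent : ∀ b → 1 ≤ b → b < m → profileSum (suc b) 0 + suc b ≤ suc (profileSum b 0 + m)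
  profileSum-adjacent b 1≤b b<m = ≤-trans (≤-reflexive (profileSum-step b 0 1≤b b<m))
                               (≤-trans (+-monoʳ-≤ (profileSum b 0) (M≤m (suc b))) (n≤1+n _))

  profileSum-hits : 1 ≤ m → ∀ {n} → suc m C 2 ≤ n → n ≤ J m →
    Σ ℕ λ b → Σ ℕ λ t → Admissible b t × profileSum b t ≡ n
  profileSum-hits 1≤m {n} C≤n n≤J
    with suc k , _ , B≤m , 2B≤1+m , m≤2B ← half-bounds 1≤m
    with b , 1≤b , b≤B , lo≤n , n≤hi ←
           interval-cover (λ b → profileSum b 0 + b) (λ b → profileSum b 0 + m) k
             (λ b 1≤b b≤k → profileSum-adjacent b 1≤b (<-≤-trans (s≤s b≤k) B≤m))
             (subst (_≤ n) (sym (profileSum-first 1≤m)) C≤n)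
             (subst (n ≤_) (sym (profileSum-last (suc k) 1≤m m≤2B)) n≤J) =
    b , n ∸ profileSum b 0 ,
    record { 1≤b = 1≤b ; b+b≤1+m = ≤-trans (+-mono-≤ b≤B b≤B) 2B≤1+m
           ; b≤t = m+n≤o⇒m≤o∸n b (subst (_≤ n) (+-comm (profileSum b 0) b) lo≤n)
           ; t≤m = m≤n+o⇒m∸n≤o n (profileSum b 0) n≤hi } ,
    trans (profileSum-slope b _ 1≤m) (m+[n∸m]≡n (m+n≤o⇒m≤o (profileSum b 0) lo≤n))

theorem2 : (m n : ℕ) → 1 ≤ m → 1 ≤ n → suc m C 2 ≤ n → n ≤ J m →
    Σ (Partition n) λ A → Σ (Partition n) λ B →
      IsKnowltonGraham A B × HasOrder A B m × IsSymmetric A B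
-- The hypothesis 1 ≤ n is implied by suc m C 2 ≤ n.
theorem2 m n 1≤m _ C≤n n≤J with b , t , admissible , sum≡n ← Profile.profileSum-hits m 1≤m C≤n n≤J =
  subst (SymmetricKG m) sum≡n (Profile.profileSum-realisable m admissible)
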